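{- $$\sum_{u\in V}\sum_{v\in N_u^- }(1-f_{uv})\le 40\cdot\mathsf{OPT}(1).$$
   Context: $G=(V,E)$ is a complete graph with every edge labeled positive or negative; every vertex has a positive self-loop. $N_u^+$ ($N_u^-$) is the set of $v$ with $(u,v)$ positive (negative), and $\Delta_u=|N_u^+|$. The correlation metric is $d_{uv}=1-\frac{|N_u^+\cap N_v^+|}{|N_u^+\cup N_v^+|}$. The adjusted correlation metric $f$: (1) set $f=d$; (2) for every negative edge $(u,v)$ with $d_{uv}>0.7$ set $f_{uv}=1$; (3) for every $u$ with $|N_u^-\cap\{v: d_{uv}\le 0.7\}|\ge\frac{10}{3}\Delta_u$, set $f_{uv}=1$ for all $v\ne u$. A clustering is a partition of $V$; a positive edge is a disagreement if its endpoints are in different clusters, a negative edge if in the same cluster; $y_{\mathcal{C}}(u)$ counts disagreements at $u$; $\mathsf{OPT}(1)=\min_{\mathcal{C}}\sum_u y_{\mathcal{C}}(u)$. -}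

module Defs where

open import Data.Nat using (ℕ; zero; suc)
open import Data.Bool using (Bool; true; false; _∧_; _∨_; not; if_then_else_)
open import Data.Fin using (Fin; zero; suc)
open import Data.Fin.Properties using () renaming (_≟_ to _≟F_)
open import Data.Integer using (+_)
open import Data.Rational using (ℚ; 0ℚ; 1ℚ; _+_; _-_; _*_; _/_; _≤ᵇ_; _≤_)
open import Data.Product using (Σ; _×_)
open import Relation.Binary.PropositionalEquality using (_≡_)
open import Relation.Nullary using (does)

-- A signed complete graph on vertex set Fin n:  sign u v = true  iff (u,v) is positive.
record SignedGraph (n : ℕ) : Set where
  field
    sign      : Fin n → Fin n → Bool
    symmetric : ∀ u v → sign u v ≡ sign v u
    selfLoop  : ∀ u → sign u u ≡ true
open SignedGraph public

sumℚ : ∀ {n} → (Fin n → ℚ) → ℚ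
sumℚ {zero}  f = 0ℚ
sumℚ {suc n} f = f zero + sumℚ (λ i → f (suc i))

count : ∀ {n} → (Fin n → Bool) → ℕ
count {zero}  p = zero
count {suc n} p = (if p zero then suc zero else zero) Data.Nat.+ count (λ i → p (suc i))

sumℕ : ∀ {n} → (Fin n → ℕ) → ℕ
sumℕ {zero}  g = zero
sumℕ {suc n} g = g zero Data.Nat.+ sumℕ (λ i → g (suc i))

ℕ→ℚ : ℕ → ℚ
ℕ→ℚ k = (+ k) / 1

-- a / b in ℚ (b = 0 never occurs below, since |N_u^+ ∪ N_v^+| ≥ 1; convention 0 there)
ratio : ℕ → ℕ → ℚ
ratio a zero    = 0ℚ
ratio a (suc b) = (+ a) / suc b

module _ {n : ℕ} (G : SignedGraph n) where

  pos : Fin n → Fin n → Bool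
  pos = sign G

  neg : Fin n → Fin n → Bool
  neg u v = not (sign G u v)

  Δ : Fin n → ℕ
  Δ u = count (pos u)

  d : Fin n → Fin n → ℚ
  d u v = 1ℚ - ratio (count (λ w → pos u w ∧ pos v w)) (count (λ w → pos u w ∨ pos v w))

  seven-tenths : ℚ
  seven-tenths = (+ 7) / 10

  heavy : Fin n → Bool
  heavy u = ((+ 10) / 3) * ℕ→ℚ (Δ u) ≤ᵇ ℕ→ℚ (count (λ v → neg u v ∧ (d u v ≤ᵇ seven-tenths)))

  f : Fin n → Fin n → ℚ
  f u v =
    if (not (does (u ≟F v)) ∧ (heavy u ∨ heavy v)) then 1ℚ
    else if (neg u v ∧ not (d u v ≤ᵇ seven-tenths)) then 1ℚ
    else d u v

  -- a clustering: cluster label of each vertex (every partition of Fin n arises this way)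
  Clustering : Set
  Clustering = Fin n → Fin n

  y : Clustering → Fin n → ℕ
  y C u = count (λ v → (pos u v ∧ not (does (C u ≟F C v)))
                     ∨ (neg u v ∧ does (C u ≟F C v)))

  cost : Clustering → ℕ
  cost C = sumℕ (y C)

  IsOPT : ℕ → Set
  IsOPT k = Σ Clustering (λ C → cost C ≡ k) × (∀ C → k Data.Nat.≤ cost C)

  negMass : ℚ
  negMass = sumℚ (λ u → sumℚ (λ v → if neg u v then 1ℚ - f u v else 0ℚ))

-- Only a negative edge uv that the adjustment leaves untouched (neither endpoint heavy,
-- d_uv ≤ 0.7) keeps mass, and that mass 1 - d_uv is at most 1, so the left-hand side is at
-- most the number B of such ordered pairs. Fix a clustering of cost OPT. If u and v share a
-- cluster, uv is a disagreement at u. Otherwise every common positive neighbour gives a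
-- disagreement at u or at v, while d_uv ≤ 0.7 means 3|N_u^+ ∪ N_v^+| ≤ 10|N_u^+ ∩ N_v^+|;
-- as |N_u^+ ∩ N_v^+| + |N_u^+ ∪ N_v^+| = Δ_u + Δ_v this gives 3(Δ_u + Δ_v) ≤ 13(y(u) + y(v)),
-- so one endpoint w is expensive: 3Δ_w ≤ 13y(w). Charge the pair to its expensive endpoints.
-- A heavy vertex has no unadjusted edges and a vertex w that is not heavy has fewer than
-- (10/3)Δ_w close negative neighbours, so an expensive w is charged at most
-- (10/3)Δ_w ≤ (130/9)y(w) times. Hence
-- B ≤ OPT + 2(130/9)OPT ≤ 40 OPT.

module Submission where

open import Defs
open import Data.Nat as ℕ using (ℕ; zero; suc; z≤n; s≤s)
import Data.Nat.Properties as ℕ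
open import Data.Nat.Tactic.RingSolver using (solve-∀)
import Data.Integer as ℤ
import Data.Integer.Properties as ℤ
open import Data.Rational as ℚ using (ℚ; _≤_; _+_; _*_; _-_; 0ℚ; 1ℚ; _≤ᵇ_; toℚᵘ)
import Data.Rational.Properties as ℚ
open import Data.Rational.Unnormalised as ℚᵘ using (mkℚᵘ; *≤*; *≡*)
import Data.Rational.Unnormalised.Properties as ℚᵘ
import Data.Rational.Solver as ℚ-Solver
open import Data.Fin using (Fin; zero; suc)
open import Data.Fin.Properties using () renaming (_≟_ to _≟F_)
open import Data.Bool using (Bool; true; false; T; not; _∧_; _∨_; if_then_else_)
open import Data.Bool.Properties using (∧-comm; ∨-comm; T?)
open import Data.Product using (_×_; _,_; proj₁; proj₂)
open import Data.Empty using (⊥; ⊥-elim)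
open import Algebra.Properties.Semiring.Sum ℕ.+-*-semiring
  using (sum; sum-syntax; ∑-distrib-+; ∑-comm; sum-cong-≗; *-distribˡ-sum)
open import Relation.Nullary using (¬_; Dec; yes; no; does)
open import Relation.Binary.PropositionalEquality

toℚᵘ-ratio : ∀ a b → toℚᵘ (ratio a (suc b)) ℚᵘ.≃ mkℚᵘ (ℤ.+ a) b
toℚᵘ-ratio a b = ℚ.toℚᵘ-fromℚᵘ (mkℚᵘ (ℤ.+ a) b)

ratio≤ratio⇒*≤* : ∀ a b c e → ratio a (suc b) ≤ ratio c (suc e) → a ℕ.* suc e ℕ.≤ c ℕ.* suc b
ratio≤ratio⇒*≤* a b c e r≤r
  with ℚᵘ.≤-respʳ-≃ (toℚᵘ-ratio c e) (ℚᵘ.≤-respˡ-≃ (toℚᵘ-ratio a b) (ℚ.toℚᵘ-mono-≤ r≤r))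
... | *≤* le = ℤ.drop‿+≤+ (subst₂ ℤ._≤_ (sym (ℤ.pos-* a (suc e))) (sym (ℤ.pos-* c (suc b))) le)

*≤*⇒ratio≤ratio : ∀ a b c e → a ℕ.* suc e ℕ.≤ c ℕ.* suc b → ratio a (suc b) ≤ ratio c (suc e)
*≤*⇒ratio≤ratio a b c e le = ℚ.toℚᵘ-cancel-≤
  (ℚᵘ.≤-respʳ-≃ (ℚᵘ.≃-sym (toℚᵘ-ratio c e)) (ℚᵘ.≤-respˡ-≃ (ℚᵘ.≃-sym (toℚᵘ-ratio a b))
    (*≤* (subst₂ ℤ._≤_ (ℤ.pos-* a (suc e)) (ℤ.pos-* c (suc b)) (ℤ.+≤+ le)))))

ℕ→ℚ-mono-≤ : ∀ {a b} → a ℕ.≤ b → ℕ→ℚ a ≤ ℕ→ℚ b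
ℕ→ℚ-mono-≤ {a} {b} a≤b =
  *≤*⇒ratio≤ratio a 0 b 0 (subst₂ ℕ._≤_ (sym (ℕ.*-identityʳ a)) (sym (ℕ.*-identityʳ b)) a≤b)

ratio≤1 : ∀ {a b} → a ℕ.≤ b → ratio a b ≤ 1ℚ
ratio≤1 {b = zero}  _   = ℚ.≤ᵇ⇒≤ _
ratio≤1 {a} {suc b} a≤b =
  *≤*⇒ratio≤ratio a b 1 0 (subst₂ ℕ._≤_ (sym (ℕ.*-identityʳ a)) (sym (ℕ.*-identityˡ (suc b))) a≤b)

ratio-*-ℕ→ℚ : ∀ a b c → ratio a (suc b) * ℕ→ℚ c ≡ ratio (a ℕ.* c) (suc b)
ratio-*-ℕ→ℚ a b c = ℚ.toℚᵘ-injective (begin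
  toℚᵘ (ratio a (suc b) * ℕ→ℚ c)            ≈⟨ ℚ.toℚᵘ-homo-* (ratio a (suc b)) (ℕ→ℚ c) ⟩
  toℚᵘ (ratio a (suc b)) ℚᵘ.* toℚᵘ (ℕ→ℚ c)  ≈⟨ ℚᵘ.*-cong (toℚᵘ-ratio a b) (toℚᵘ-ratio c 0) ⟩
  mkℚᵘ (ℤ.+ a) b ℚᵘ.* mkℚᵘ (ℤ.+ c) 0        ≈⟨ *≡* (cong₂ ℤ._*_ (sym (ℤ.pos-* a c)) denominator) ⟩
  mkℚᵘ (ℤ.+ (a ℕ.* c)) b                    ≈⟨ toℚᵘ-ratio (a ℕ.* c) b ⟨
  toℚᵘ (ratio (a ℕ.* c) (suc b))            ∎)
  where
  open ℚᵘ.≃-Reasoning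
  denominator : ℤ.+ suc b ≡ ℤ.+ suc (b ℕ.* 1)
  denominator = cong (λ k → ℤ.+ suc k) (sym (ℕ.*-identityʳ b))

ratio-*-ℕ→ℚ-≤ : ∀ a b c e → a ℕ.* c ℕ.≤ suc b ℕ.* e → ratio a (suc b) * ℕ→ℚ c ≤ ℕ→ℚ e
ratio-*-ℕ→ℚ-≤ a b c e ac≤be = subst (_≤ ℕ→ℚ e) (sym (ratio-*-ℕ→ℚ a b c))
  (*≤*⇒ratio≤ratio (a ℕ.* c) b e 0
    (subst₂ ℕ._≤_ (sym (ℕ.*-identityʳ (a ℕ.* c))) (ℕ.*-comm (suc b) e) ac≤be))

ℕ→ℚ-homo-+ : ∀ a b → ℕ→ℚ (a ℕ.+ b) ≡ ℕ→ℚ a + ℕ→ℚ b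
ℕ→ℚ-homo-+ a b = ℚ.toℚᵘ-injective (begin
  toℚᵘ (ℕ→ℚ (a ℕ.+ b))                 ≈⟨ toℚᵘ-ratio (a ℕ.+ b) 0 ⟩
  mkℚᵘ (ℤ.+ (a ℕ.+ b)) 0               ≈⟨ *≡* (cong₂ ℤ._*_ numerator refl) ⟩
  mkℚᵘ (ℤ.+ a) 0 ℚᵘ.+ mkℚᵘ (ℤ.+ b) 0   ≈⟨ ℚᵘ.+-cong (toℚᵘ-ratio a 0) (toℚᵘ-ratio b 0) ⟨
  toℚᵘ (ℕ→ℚ a) ℚᵘ.+ toℚᵘ (ℕ→ℚ b)       ≈⟨ ℚ.toℚᵘ-homo-+ (ℕ→ℚ a) (ℕ→ℚ b) ⟨
  toℚᵘ (ℕ→ℚ a + ℕ→ℚ b)                 ∎)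
  where
  open ℚᵘ.≃-Reasoning
  numerator : ℤ.+ (a ℕ.+ b) ≡ ℤ.+ a ℤ.* ℤ.+ 1 ℤ.+ ℤ.+ b ℤ.* ℤ.+ 1
  numerator = trans (ℤ.pos-+ a b) (sym (cong₂ ℤ._+_ (ℤ.*-identityʳ (ℤ.+ a)) (ℤ.*-identityʳ (ℤ.+ b))))

p-q≤r⇒p-r≤q : ∀ p q r → p - q ≤ r → p - r ≤ q
p-q≤r⇒p-r≤q p q r p-q≤r = begin
  p - r                 ≡⟨ split p q r ⟩
  (p - q) + (q - r)     ≤⟨ ℚ.+-monoˡ-≤ (q - r) p-q≤r ⟩
  r + (q - r)           ≡⟨ cancel q r ⟩
  q                     ∎
  where
  open ℚ.≤-Reasoning
  open ℚ-Solver.+-*-Solver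
  split : ∀ p q r → p - r ≡ (p - q) + (q - r)
  split = solve 3 (λ p q r → p :- r := (p :- q) :+ (q :- r)) refl
  cancel : ∀ q r → r + (q - r) ≡ q
  cancel = solve 2 (λ q r → r :+ (q :- r) := q) refl

1-ratio≤7/10⇒3b≤10a : ∀ a b → 1ℚ - ratio a b ≤ ratio 7 10 → 3 ℕ.* b ℕ.≤ 10 ℕ.* a
1-ratio≤7/10⇒3b≤10a a zero    _      = z≤n
1-ratio≤7/10⇒3b≤10a a (suc b) 1-r≤7/10 = subst (3 ℕ.* suc b ℕ.≤_) (ℕ.*-comm a 10)
  (ratio≤ratio⇒*≤* 3 9 a b (p-q≤r⇒p-r≤q 1ℚ (ratio a (suc b)) (ratio 7 10) 1-r≤7/10))

T-∨ˡ : ∀ a b → T a → T (a ∨ b)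
T-∨ˡ true b _ = _

T-∨ʳ : ∀ a b → T b → T (a ∨ b)
T-∨ʳ true  b _ = _
T-∨ʳ false b t = t

T-∧-proj₁ : ∀ a b → T (a ∧ b) → T a
T-∧-proj₁ true b _ = _

T-∧-proj₂ : ∀ a b → T (a ∧ b) → T b
T-∧-proj₂ true b t = t

∧-not-split : ∀ a h c → T (a ∧ not h ∧ c) → T (a ∧ c) × ¬ T h
∧-not-split true false true _ = _ , λ ()

conjoin-hypothesis : ∀ a b c e → (T a → T (b ∨ c ∨ e)) → T a → T (b ∨ (c ∧ a) ∨ (e ∧ a))
conjoin-hypothesis true true  _     _     _      _ = _
conjoin-hypothesis true false true  _     _      _ = _
conjoin-hypothesis true false false true  _      _ = _
conjoin-hypothesis true false false false a⇒b∨c∨e t = a⇒b∨c∨e t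

T-does⇒ : ∀ {A : Set} (a? : Dec A) → T (does a?) → A
T-does⇒ (yes a) _ = a

⇒T-does : ∀ {A : Set} (a? : Dec A) → A → T (does a?)
⇒T-does (yes _)  _ = _
⇒T-does (no ¬a) a = ¬a a

sumℕ≡sum : ∀ {n} (g : Fin n → ℕ) → sumℕ g ≡ sum g
sumℕ≡sum {zero}  g = refl
sumℕ≡sum {suc n} g = cong (g zero ℕ.+_) (sumℕ≡sum (λ i → g (suc i)))

sum-mono-≤ : ∀ {n} {g h : Fin n → ℕ} → (∀ i → g i ℕ.≤ h i) → sum g ℕ.≤ sum h
sum-mono-≤ {zero}  g≤h = z≤n
sum-mono-≤ {suc n} g≤h = ℕ.+-mono-≤ (g≤h zero) (sum-mono-≤ (λ i → g≤h (suc i)))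

sumℚ-cong : ∀ {n} {g h : Fin n → ℚ} → (∀ i → g i ≡ h i) → sumℚ g ≡ sumℚ h
sumℚ-cong {zero}  g≗h = refl
sumℚ-cong {suc n} g≗h = cong₂ _+_ (g≗h zero) (sumℚ-cong (λ i → g≗h (suc i)))

sumℚ-mono-≤ : ∀ {n} {g h : Fin n → ℚ} → (∀ i → g i ≤ h i) → sumℚ g ≤ sumℚ h
sumℚ-mono-≤ {zero}  g≤h = ℚ.≤-refl
sumℚ-mono-≤ {suc n} g≤h = ℚ.+-mono-≤ (g≤h zero) (sumℚ-mono-≤ (λ i → g≤h (suc i)))

sumℚ-ℕ→ℚ : ∀ {n} (g : Fin n → ℕ) → sumℚ (λ i → ℕ→ℚ (g i)) ≡ ℕ→ℚ (sum g)
sumℚ-ℕ→ℚ {zero}  g = refl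
sumℚ-ℕ→ℚ {suc n} g =
  trans (cong (ℕ→ℚ (g zero) +_) (sumℚ-ℕ→ℚ (λ i → g (suc i)))) (sym (ℕ→ℚ-homo-+ (g zero) _))

𝟙 : Bool → ℕ
𝟙 b = if b then 1 else 0

𝟙-mono-≤ : ∀ {a b} → (T a → T b) → 𝟙 a ℕ.≤ 𝟙 b
𝟙-mono-≤ {false}          _ = z≤n
𝟙-mono-≤ {true}  {true}   _ = ℕ.≤-refl
𝟙-mono-≤ {true}  {false} a⇒b = ⊥-elim (a⇒b _)

𝟙-∨-≤ : ∀ a b → 𝟙 (a ∨ b) ℕ.≤ 𝟙 a ℕ.+ 𝟙 b
𝟙-∨-≤ true  b = s≤s z≤n
𝟙-∨-≤ false b = ℕ.≤-refl

𝟙-∧+𝟙-∨ : ∀ a b → 𝟙 (a ∧ b) ℕ.+ 𝟙 (a ∨ b) ≡ 𝟙 a ℕ.+ 𝟙 b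
𝟙-∧+𝟙-∨ true  true  = refl
𝟙-∧+𝟙-∨ true  false = refl
𝟙-∧+𝟙-∨ false b     = refl

count≡∑𝟙 : ∀ {n} (p : Fin n → Bool) → count p ≡ ∑[ i < n ] 𝟙 (p i)
count≡∑𝟙 {zero}  p = refl
count≡∑𝟙 {suc n} p = cong (𝟙 (p zero) ℕ.+_) (count≡∑𝟙 (λ i → p (suc i)))

count-cong : ∀ {n} {p q : Fin n → Bool} → (∀ i → p i ≡ q i) → count p ≡ count q
count-cong {p = p} {q} p≗q =
  trans (count≡∑𝟙 p) (trans (sum-cong-≗ (λ i → cong 𝟙 (p≗q i))) (sym (count≡∑𝟙 q)))

count-mono-≤ : ∀ {n} {p q : Fin n → Bool} → (∀ i → T (p i) → T (q i)) → count p ℕ.≤ count q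
count-mono-≤ {p = p} {q} p⇒q = subst₂ ℕ._≤_ (sym (count≡∑𝟙 p)) (sym (count≡∑𝟙 q))
  (sum-mono-≤ (λ i → 𝟙-mono-≤ (p⇒q i)))

count-false : ∀ {n} → count {n} (λ _ → false) ≡ 0
count-false {zero}  = refl
count-false {suc n} = count-false {n}

count-none : ∀ {n} {p : Fin n → Bool} → (∀ i → ¬ T (p i)) → count p ≡ 0
count-none {n} {p} ¬p = ℕ.n≤0⇒n≡0 (subst (count p ℕ.≤_) (count-false {n}) (count-mono-≤ ¬p))

count-∨-≤ : ∀ {n} (p q : Fin n → Bool) → count (λ i → p i ∨ q i) ℕ.≤ count p ℕ.+ count q
count-∨-≤ {n} p q = begin
  count (λ i → p i ∨ q i)               ≡⟨ count≡∑𝟙 (λ i → p i ∨ q i) ⟩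
  ∑[ i < n ] 𝟙 (p i ∨ q i)              ≤⟨ sum-mono-≤ (λ i → 𝟙-∨-≤ (p i) (q i)) ⟩
  ∑[ i < n ] (𝟙 (p i) ℕ.+ 𝟙 (q i))      ≡⟨ ∑-distrib-+ (λ i → 𝟙 (p i)) (λ i → 𝟙 (q i)) ⟩
  ∑[ i < n ] 𝟙 (p i) ℕ.+ ∑[ i < n ] 𝟙 (q i) ≡⟨ cong₂ ℕ._+_ (count≡∑𝟙 p) (count≡∑𝟙 q) ⟨
  count p ℕ.+ count q                   ∎
  where open ℕ.≤-Reasoning

count-∧+count-∨ : ∀ {n} (p q : Fin n → Bool) →
                  count (λ i → p i ∧ q i) ℕ.+ count (λ i → p i ∨ q i) ≡ count p ℕ.+ count q
count-∧+count-∨ {n} p q = begin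
  count (λ i → p i ∧ q i) ℕ.+ count (λ i → p i ∨ q i)
    ≡⟨ cong₂ ℕ._+_ (count≡∑𝟙 (λ i → p i ∧ q i)) (count≡∑𝟙 (λ i → p i ∨ q i)) ⟩
  ∑[ i < n ] 𝟙 (p i ∧ q i) ℕ.+ ∑[ i < n ] 𝟙 (p i ∨ q i)
    ≡⟨ ∑-distrib-+ (λ i → 𝟙 (p i ∧ q i)) (λ i → 𝟙 (p i ∨ q i)) ⟨
  ∑[ i < n ] (𝟙 (p i ∧ q i) ℕ.+ 𝟙 (p i ∨ q i))
    ≡⟨ sum-cong-≗ (λ i → 𝟙-∧+𝟙-∨ (p i) (q i)) ⟩
  ∑[ i < n ] (𝟙 (p i) ℕ.+ 𝟙 (q i))
    ≡⟨ ∑-distrib-+ (λ i → 𝟙 (p i)) (λ i → 𝟙 (q i)) ⟩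
  ∑[ i < n ] 𝟙 (p i) ℕ.+ ∑[ i < n ] 𝟙 (q i)
    ≡⟨ cong₂ ℕ._+_ (count≡∑𝟙 p) (count≡∑𝟙 q) ⟨
  count p ℕ.+ count q ∎
  where open ≡-Reasoning

+-≤⇒≤ᵇ-∨ : ∀ a b c e → a ℕ.+ b ℕ.≤ c ℕ.+ e → T ((a ℕ.≤ᵇ c) ∨ (b ℕ.≤ᵇ e))
+-≤⇒≤ᵇ-∨ a b c e a+b≤c+e with a ℕ.≤? c | b ℕ.≤? e
... | yes a≤c | _       = T-∨ˡ (a ℕ.≤ᵇ c) _ (ℕ.≤⇒≤ᵇ a≤c)
... | no  _   | yes b≤e = T-∨ʳ (a ℕ.≤ᵇ c) _ (ℕ.≤⇒≤ᵇ b≤e)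
... | no  a≰c | no  b≰e = ⊥-elim (ℕ.<⇒≱ (ℕ.+-mono-< (ℕ.≰⇒> a≰c) (ℕ.≰⇒> b≰e)) a+b≤c+e)

b≤c+[t+t]⇒9t≤130c⇒b≤40c : ∀ {b c t} → b ℕ.≤ c ℕ.+ (t ℕ.+ t) → 9 ℕ.* t ℕ.≤ 130 ℕ.* c → b ℕ.≤ 40 ℕ.* c
b≤c+[t+t]⇒9t≤130c⇒b≤40c {b} {c} {t} b≤c+2t 9t≤130c = ℕ.*-cancelˡ-≤ 9 (begin
  9 ℕ.* b                                       ≤⟨ ℕ.*-monoʳ-≤ 9 b≤c+2t ⟩
  9 ℕ.* (c ℕ.+ (t ℕ.+ t))                       ≡⟨ distrib c t ⟩
  9 ℕ.* c ℕ.+ (9 ℕ.* t ℕ.+ 9 ℕ.* t)             ≤⟨ ℕ.+-monoʳ-≤ (9 ℕ.* c) (ℕ.+-mono-≤ 9t≤130c 9t≤130c) ⟩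
  9 ℕ.* c ℕ.+ (130 ℕ.* c ℕ.+ 130 ℕ.* c)         ≤⟨ ℕ.m≤m+n _ (91 ℕ.* c) ⟩
  9 ℕ.* c ℕ.+ (130 ℕ.* c ℕ.+ 130 ℕ.* c) ℕ.+ 91 ℕ.* c ≡⟨ collect c ⟩
  9 ℕ.* (40 ℕ.* c)                              ∎)
  where
  open ℕ.≤-Reasoning
  distrib : ∀ c t → 9 ℕ.* (c ℕ.+ (t ℕ.+ t)) ≡ 9 ℕ.* c ℕ.+ (9 ℕ.* t ℕ.+ 9 ℕ.* t)
  distrib = solve-∀
  collect : ∀ c → 9 ℕ.* c ℕ.+ (130 ℕ.* c ℕ.+ 130 ℕ.* c) ℕ.+ 91 ℕ.* c ≡ 9 ℕ.* (40 ℕ.* c)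
  collect = solve-∀

-- The summand of negMass with f unfolded: s = sign u v, e = [u = v], h = heavy u ∨ heavy v,
-- c = [d u v ≤ 0.7] and δ = d u v.
1-f≤𝟙 : ∀ s e h c (δ : ℚ) → (T e → T s) → 1ℚ - δ ≤ 1ℚ →
  (if not s then 1ℚ - (if not e ∧ h then 1ℚ else if not s ∧ not c then 1ℚ else δ) else 0ℚ)
    ≤ ℕ→ℚ (𝟙 (not s ∧ not h ∧ c))
1-f≤𝟙 true  e     h     c     δ _   _   = ℚ.≤-refl
1-f≤𝟙 false true  h     c     δ e⇒s _   = ⊥-elim (e⇒s _)
1-f≤𝟙 false false true  c     δ _   _   = ℚ.≤-refl
1-f≤𝟙 false false false false δ _   _   = ℚ.≤-refl
1-f≤𝟙 false false false true  δ _   1-δ≤1 = 1-δ≤1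

neg∧same⇒disagreement : ∀ s e → T (not s) → T e → T ((s ∧ not e) ∨ (not s ∧ e))
neg∧same⇒disagreement false true _ _ = _

common∧separated⇒disagreement : ∀ a b e₁ e₂ → (T e₁ → T e₂ → ⊥) → T (a ∧ b) →
  T (((a ∧ not e₁) ∨ (not a ∧ e₁)) ∨ ((b ∧ not e₂) ∨ (not b ∧ e₂)))
common∧separated⇒disagreement true true false _     _     _ = _
common∧separated⇒disagreement true true true  false _     _ = _
common∧separated⇒disagreement true true true  true  ¬both _ = ¬both _ _

module _ {n : ℕ} (G : SignedGraph n) where

  close : Fin n → Fin n → Bool
  close u v = d G u v ≤ᵇ seven-tenths G

  -- The negative edges on which steps (2) and (3) leave f = d.
  unadjusted : Fin n → Fin n → Bool
  unadjusted u v = neg G u v ∧ not (heavy G u ∨ heavy G v) ∧ close u v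

  inter union : Fin n → Fin n → ℕ
  inter u v = count (λ w → pos G u w ∧ pos G v w)
  union u v = count (λ w → pos G u w ∨ pos G v w)

  inter≤union : ∀ u v → inter u v ℕ.≤ union u v
  inter≤union u v = count-mono-≤ λ w t →
    T-∨ˡ (pos G u w) (pos G v w) (T-∧-proj₁ (pos G u w) (pos G v w) t)

  inter+union≡Δ+Δ : ∀ u v → inter u v ℕ.+ union u v ≡ Δ G u ℕ.+ Δ G v
  inter+union≡Δ+Δ u v = count-∧+count-∨ (pos G u) (pos G v)

  d-sym : ∀ u v → d G u v ≡ d G v u
  d-sym u v = cong₂ (λ i j → 1ℚ - ratio i j)
    (count-cong {p = λ w → pos G u w ∧ pos G v w} λ w → ∧-comm (pos G u w) (pos G v w))
    (count-cong {p = λ w → pos G u w ∨ pos G v w} λ w → ∨-comm (pos G u w) (pos G v w))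

  unadjusted-sym : ∀ u v → unadjusted u v ≡ unadjusted v u
  unadjusted-sym u v = cong₂ (λ s c → not s ∧ c) (symmetric G u v)
    (cong₂ (λ h c → not h ∧ c) (∨-comm (heavy G u) (heavy G v))
                               (cong (_≤ᵇ seven-tenths G) (d-sym u v)))

  1-d≤1 : ∀ u v → 1ℚ - d G u v ≤ 1ℚ
  1-d≤1 u v = subst (_≤ 1ℚ) (sym (1-[1-r]≡r (ratio (inter u v) (union u v))))
                    (ratio≤1 (inter≤union u v))
    where
    open ℚ-Solver.+-*-Solver
    1-[1-r]≡r : ∀ r → 1ℚ - (1ℚ - r) ≡ r
    1-[1-r]≡r = solve 1 (λ r → con 1ℚ :- (con 1ℚ :- r) := r) refl

  loop⇒positive : ∀ u v → T (does (u ≟F v)) → T (pos G u v)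
  loop⇒positive u v u≡v with u ≟F v
  ... | yes refl = subst T (sym (selfLoop G u)) _

  negTerm≤𝟙-unadjusted : ∀ u v →
    (if neg G u v then 1ℚ - f G u v else 0ℚ) ≤ ℕ→ℚ (𝟙 (unadjusted u v))
  negTerm≤𝟙-unadjusted u v =
    1-f≤𝟙 (sign G u v) (does (u ≟F v)) (heavy G u ∨ heavy G v) (close u v) (d G u v)
          (loop⇒positive u v) (1-d≤1 u v)

  negMass≤∑unadjusted : negMass G ≤ ℕ→ℚ (∑[ u < n ] count (unadjusted u))
  negMass≤∑unadjusted = begin
    negMass G
      ≤⟨ sumℚ-mono-≤ (λ u → sumℚ-mono-≤ (negTerm≤𝟙-unadjusted u)) ⟩
    sumℚ (λ u → sumℚ (λ v → ℕ→ℚ (𝟙 (unadjusted u v))))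
      ≡⟨ sumℚ-cong (λ u → trans (sumℚ-ℕ→ℚ (λ v → 𝟙 (unadjusted u v)))
                                (cong ℕ→ℚ (sym (count≡∑𝟙 (unadjusted u))))) ⟩
    sumℚ (λ u → ℕ→ℚ (count (unadjusted u)))
      ≡⟨ sumℚ-ℕ→ℚ (λ u → count (unadjusted u)) ⟩
    ℕ→ℚ (∑[ u < n ] count (unadjusted u)) ∎
    where open ℚ.≤-Reasoning

  close⇒3union≤10inter : ∀ u v → T (close u v) → 3 ℕ.* union u v ℕ.≤ 10 ℕ.* inter u v
  close⇒3union≤10inter u v uv-close =
    1-ratio≤7/10⇒3b≤10a (inter u v) (union u v) (ℚ.≤ᵇ⇒≤ uv-close)

  closeNegatives : Fin n → ℕ
  closeNegatives u = count (λ v → neg G u v ∧ close u v)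

  light⇒3closeNegatives<10Δ : ∀ u → ¬ T (heavy G u) → 3 ℕ.* closeNegatives u ℕ.< 10 ℕ.* Δ G u
  light⇒3closeNegatives<10Δ u u-light = ℕ.≰⇒> λ 10Δ≤3c →
    u-light (ℚ.≤⇒≤ᵇ (ratio-*-ℕ→ℚ-≤ 10 2 (Δ G u) (closeNegatives u) 10Δ≤3c))

  3unadjusted≤10Δ : ∀ u → 3 ℕ.* count (unadjusted u) ℕ.≤ 10 ℕ.* Δ G u
  3unadjusted≤10Δ u = by-cases (T? (heavy G u))
    -- Case analysis by a helper rather than with: abstracting heavy G u in the goal makes
    -- Agda normalise the rational arithmetic inside it.
    where
    split : ∀ {v} → T (unadjusted u v) → T (neg G u v ∧ close u v) × ¬ T (heavy G u ∨ heavy G v)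
    split {v} = ∧-not-split (neg G u v) (heavy G u ∨ heavy G v) (close u v)
    by-cases : Dec (T (heavy G u)) → 3 ℕ.* count (unadjusted u) ℕ.≤ 10 ℕ.* Δ G u
    by-cases (yes u-heavy) = subst (λ k → 3 ℕ.* k ℕ.≤ 10 ℕ.* Δ G u)
      (sym (count-none {p = unadjusted u} λ v t →
              proj₂ (split t) (T-∨ˡ (heavy G u) (heavy G v) u-heavy)))
      z≤n
    by-cases (no u-light) = ℕ.≤-trans
      (ℕ.*-monoʳ-≤ 3 (count-mono-≤ {p = unadjusted u} {q = λ v → neg G u v ∧ close u v}
                                    λ v t → proj₁ (split t)))
      (ℕ.<⇒≤ (light⇒3closeNegatives<10Δ u u-light))

  module _ (C : Clustering G) where

    disagrees : Fin n → Fin n → Bool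
    disagrees u v = (pos G u v ∧ not (does (C u ≟F C v))) ∨ (neg G u v ∧ does (C u ≟F C v))

    expensive : Fin n → Bool
    expensive u = 3 ℕ.* Δ G u ℕ.≤ᵇ 13 ℕ.* y G C u

    inter≤y+y : ∀ u v → C u ≢ C v → inter u v ℕ.≤ y G C u ℕ.+ y G C v
    inter≤y+y u v Cu≢Cv = ℕ.≤-trans
      (count-mono-≤ {p = λ w → pos G u w ∧ pos G v w} {q = λ w → disagrees u w ∨ disagrees v w}
        λ w → common∧separated⇒disagreement
                (pos G u w) (pos G v w) (does (C u ≟F C w)) (does (C v ≟F C w))
                λ u~w v~w → Cu≢Cv (trans (T-does⇒ (C u ≟F C w) u~w) (sym (T-does⇒ (C v ≟F C w) v~w))))
      (count-∨-≤ (disagrees u) (disagrees v))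

    separated⇒3Δ+3Δ≤13y+13y : ∀ u v → T (close u v) → C u ≢ C v →
                              3 ℕ.* Δ G u ℕ.+ 3 ℕ.* Δ G v ℕ.≤ 13 ℕ.* y G C u ℕ.+ 13 ℕ.* y G C v
    separated⇒3Δ+3Δ≤13y+13y u v uv-close Cu≢Cv = begin
      3 ℕ.* Δ G u ℕ.+ 3 ℕ.* Δ G v          ≡⟨ ℕ.*-distribˡ-+ 3 (Δ G u) (Δ G v) ⟨
      3 ℕ.* (Δ G u ℕ.+ Δ G v)              ≡⟨ cong (3 ℕ.*_) (inter+union≡Δ+Δ u v) ⟨
      3 ℕ.* (inter u v ℕ.+ union u v)      ≡⟨ ℕ.*-distribˡ-+ 3 (inter u v) (union u v) ⟩
      3 ℕ.* inter u v ℕ.+ 3 ℕ.* union u v  ≤⟨ ℕ.+-monoʳ-≤ (3 ℕ.* inter u v)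
                                                        (close⇒3union≤10inter u v uv-close) ⟩
      3 ℕ.* inter u v ℕ.+ 10 ℕ.* inter u v ≡⟨ ℕ.*-distribʳ-+ (inter u v) 3 10 ⟨
      13 ℕ.* inter u v                     ≤⟨ ℕ.*-monoʳ-≤ 13 (inter≤y+y u v Cu≢Cv) ⟩
      13 ℕ.* (y G C u ℕ.+ y G C v)         ≡⟨ ℕ.*-distribˡ-+ 13 (y G C u) (y G C v) ⟩
      13 ℕ.* y G C u ℕ.+ 13 ℕ.* y G C v    ∎
      where open ℕ.≤-Reasoning

    unadjusted⇒disagrees∨expensive : ∀ u v → T (unadjusted u v) →
                                     T (disagrees u v ∨ expensive u ∨ expensive v)
    unadjusted⇒disagrees∨expensive u v uv-unadjusted = by-cases (C u ≟F C v)
      where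
      negative∧close : T (neg G u v ∧ close u v)
      negative∧close =
        proj₁ (∧-not-split (neg G u v) (heavy G u ∨ heavy G v) (close u v) uv-unadjusted)
      by-cases : Dec (C u ≡ C v) → T (disagrees u v ∨ expensive u ∨ expensive v)
      by-cases (yes Cu≡Cv) = T-∨ˡ (disagrees u v) _
        (neg∧same⇒disagreement (sign G u v) (does (C u ≟F C v))
          (T-∧-proj₁ (neg G u v) (close u v) negative∧close) (⇒T-does (C u ≟F C v) Cu≡Cv))
      by-cases (no Cu≢Cv) = T-∨ʳ (disagrees u v) _
        (+-≤⇒≤ᵇ-∨ (3 ℕ.* Δ G u) (3 ℕ.* Δ G v) (13 ℕ.* y G C u) (13 ℕ.* y G C v)
          (separated⇒3Δ+3Δ≤13y+13y u v (T-∧-proj₂ (neg G u v) (close u v) negative∧close) Cu≢Cv))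

    charged : Fin n → Fin n → Bool
    charged u v = expensive u ∧ unadjusted u v

    charge received : Fin n → ℕ
    charge   u = count (charged u)
    received u = count (λ v → charged v u)

    unadjusted≤y+charge+received : ∀ u → count (unadjusted u) ℕ.≤ y G C u ℕ.+ (charge u ℕ.+ received u)
    unadjusted≤y+charge+received u = begin
      count (unadjusted u)
        ≤⟨ count-mono-≤ {p = unadjusted u} {q = λ v → disagrees u v ∨ (charged u v ∨ charged v u)}
                        unadjusted⇒disagrees∨charged ⟩
      count (λ v → disagrees u v ∨ (charged u v ∨ charged v u))
        ≤⟨ count-∨-≤ (disagrees u) (λ v → charged u v ∨ charged v u) ⟩
      y G C u ℕ.+ count (λ v → charged u v ∨ charged v u)
        ≤⟨ ℕ.+-monoʳ-≤ (y G C u) (count-∨-≤ (charged u) (λ v → charged v u)) ⟩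
      y G C u ℕ.+ (charge u ℕ.+ received u) ∎
      where
      open ℕ.≤-Reasoning
      unadjusted⇒disagrees∨charged : ∀ v → T (unadjusted u v) →
                                     T (disagrees u v ∨ (charged u v ∨ charged v u))
      unadjusted⇒disagrees∨charged v =
        subst (λ a → T (unadjusted u v) → T (disagrees u v ∨ (charged u v ∨ (expensive v ∧ a))))
              (unadjusted-sym u v)
              (conjoin-hypothesis (unadjusted u v) (disagrees u v) (expensive u) (expensive v)
                                  (unadjusted⇒disagrees∨expensive u v))

    9charge≤130y : ∀ u → 9 ℕ.* charge u ℕ.≤ 130 ℕ.* y G C u
    9charge≤130y u = by-cases (T? (expensive u))
      where
      open ℕ.≤-Reasoning
      by-cases : Dec (T (expensive u)) → 9 ℕ.* charge u ℕ.≤ 130 ℕ.* y G C u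
      by-cases (no u-cheap) = subst (λ k → 9 ℕ.* k ℕ.≤ 130 ℕ.* y G C u)
        (sym (count-none {p = charged u} λ v t →
                u-cheap (T-∧-proj₁ (expensive u) (unadjusted u v) t)))
        z≤n
      by-cases (yes u-expensive) = begin
        9 ℕ.* charge u
          ≤⟨ ℕ.*-monoʳ-≤ 9 (count-mono-≤ {p = charged u} {q = unadjusted u}
                                          λ v → T-∧-proj₂ (expensive u) (unadjusted u v)) ⟩
        9 ℕ.* count (unadjusted u)         ≡⟨ ℕ.*-assoc 3 3 (count (unadjusted u)) ⟩
        3 ℕ.* (3 ℕ.* count (unadjusted u)) ≤⟨ ℕ.*-monoʳ-≤ 3 (3unadjusted≤10Δ u) ⟩
        3 ℕ.* (10 ℕ.* Δ G u)               ≡⟨ trans (sym (ℕ.*-assoc 3 10 (Δ G u))) (ℕ.*-assoc 10 3 (Δ G u)) ⟩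
        10 ℕ.* (3 ℕ.* Δ G u)               ≤⟨ ℕ.*-monoʳ-≤ 10 (ℕ.≤ᵇ⇒≤ (3 ℕ.* Δ G u) (13 ℕ.* y G C u) u-expensive) ⟩
        10 ℕ.* (13 ℕ.* y G C u)            ≡⟨ ℕ.*-assoc 10 13 (y G C u) ⟨
        130 ℕ.* y G C u                    ∎

    ∑received≡∑charge : ∑[ u < n ] received u ≡ ∑[ u < n ] charge u
    ∑received≡∑charge = begin
      ∑[ u < n ] received u                    ≡⟨ sum-cong-≗ (λ u → count≡∑𝟙 (λ v → charged v u)) ⟩
      ∑[ u < n ] ∑[ v < n ] 𝟙 (charged v u)    ≡⟨ ∑-comm (λ u v → 𝟙 (charged v u)) ⟩
      ∑[ v < n ] ∑[ u < n ] 𝟙 (charged v u)    ≡⟨ sum-cong-≗ (λ v → count≡∑𝟙 (charged v)) ⟨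
      ∑[ v < n ] charge v                      ∎
      where open ≡-Reasoning

    ∑unadjusted≤cost+2∑charge :
      ∑[ u < n ] count (unadjusted u) ℕ.≤ cost G C ℕ.+ (∑[ u < n ] charge u ℕ.+ ∑[ u < n ] charge u)
    ∑unadjusted≤cost+2∑charge = begin
      ∑[ u < n ] count (unadjusted u)
        ≤⟨ sum-mono-≤ unadjusted≤y+charge+received ⟩
      ∑[ u < n ] (y G C u ℕ.+ (charge u ℕ.+ received u))
        ≡⟨ ∑-distrib-+ (y G C) (λ u → charge u ℕ.+ received u) ⟩
      ∑[ u < n ] y G C u ℕ.+ ∑[ u < n ] (charge u ℕ.+ received u)
        ≡⟨ cong₂ ℕ._+_ (sumℕ≡sum (y G C)) (sym (∑-distrib-+ charge received)) ⟨
      cost G C ℕ.+ (∑[ u < n ] charge u ℕ.+ ∑[ u < n ] received u)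
        ≡⟨ cong (λ r → cost G C ℕ.+ (∑[ u < n ] charge u ℕ.+ r)) ∑received≡∑charge ⟩
      cost G C ℕ.+ (∑[ u < n ] charge u ℕ.+ ∑[ u < n ] charge u) ∎
      where open ℕ.≤-Reasoning

    9∑charge≤130cost : 9 ℕ.* ∑[ u < n ] charge u ℕ.≤ 130 ℕ.* cost G C
    9∑charge≤130cost = begin
      9 ℕ.* ∑[ u < n ] charge u    ≡⟨ *-distribˡ-sum 9 charge ⟩
      ∑[ u < n ] (9 ℕ.* charge u)  ≤⟨ sum-mono-≤ 9charge≤130y ⟩
      ∑[ u < n ] (130 ℕ.* y G C u) ≡⟨ *-distribˡ-sum 130 (y G C) ⟨
      130 ℕ.* ∑[ u < n ] y G C u   ≡⟨ cong (130 ℕ.*_) (sumℕ≡sum (y G C)) ⟨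
      130 ℕ.* cost G C             ∎
      where open ℕ.≤-Reasoning

    ∑unadjusted≤40cost : ∑[ u < n ] count (unadjusted u) ℕ.≤ 40 ℕ.* cost G C
    ∑unadjusted≤40cost = b≤c+[t+t]⇒9t≤130c⇒b≤40c {c = cost G C} {t = ∑[ u < n ] charge u}
      ∑unadjusted≤cost+2∑charge 9∑charge≤130cost

lemma9 : (n : ℕ) (G : SignedGraph n) (opt : ℕ) → IsOPT G opt → negMass G ≤ ℕ→ℚ 40 * ℕ→ℚ opt
lemma9 n G opt ((C , cost≡opt) , _) = begin
  negMass G                               ≤⟨ negMass≤∑unadjusted G ⟩
  ℕ→ℚ (∑[ u < n ] count (unadjusted G u)) ≤⟨ ℕ→ℚ-mono-≤ (∑unadjusted≤40cost G C) ⟩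
  ℕ→ℚ (40 ℕ.* cost G C)                   ≡⟨ cong (λ k → ℕ→ℚ (40 ℕ.* k)) cost≡opt ⟩
  ℕ→ℚ (40 ℕ.* opt)                        ≡⟨ ratio-*-ℕ→ℚ 40 0 opt ⟨
  ℕ→ℚ 40 * ℕ→ℚ opt                        ∎
  where open ℚ.≤-Reasoning
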